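{- Let $P$ be a finite poset, $\ell$ a positive integer, $u,v$ as in the context, and $R$ a restriction function that is consistent with respect to $P\times[\ell]^v_u$ and also consistent on $P$. Then $\Gamma(P,R)\subseteq\Gamma(P,\hat R)$ as sets, and the restriction map $\sigma\mapsto\sigma|_{\Gamma(P,R)}$ is a bijection from $\mathcal A^{\hat B}(\Gamma(P,\hat R))$ onto $\mathcal A^{\delta}_{\epsilon}(\Gamma(P,R))$, where $\delta(p,k)=\ell-u(p)$ and $\epsilon(p,k)=v(p)$ for $(p,k)\in\Gamma(P,R)$.
   Context: $P\times[\ell]=\{(p,i):p\in P,1\le i\le\ell\}$ with product order; $u,v:P\to\{0,\ldots,\ell\}$ satisfy $u(p)+v(p)\le\ell$ and $v(p_1)\le v(p_2)$, $u(p_1)\ge u(p_2)$ when $p_1\le_Pp_2$; $P\times[\ell]^v_u=\{(p,i):u(p)<i<\ell+1-v(p)\}$. A restriction function $R$ maps $P$ to nonempty finite subsets of $\mathbb Z$. $R$ is consistent w.r.t. $P\times[\ell]^v_u$ if for all $p$ and $k\in R(p)$ there is $f:P\times[\ell]^v_u\to\mathbb Z$ with $f(p_1,i)<f(p_2,i)$ for $p_1<_Pp_2$, $f(p,i_1)\le f(p,i_2)$ for $i_1\le i_2$, $f(x,i)\in R(x)$, and $f(p,i)=k$ for some $(p,i)$ in the domain. $R$ is consistent on $P$ if for every $p$ and $k\in R(p)$ there is $f:P\to\mathbb Z$ with $f(p_1)<f(p_2)$ for $p_1<_Pp_2$, $f(x)\in R(x)$ for all $x$, and $f(p)=k$. $R(p)_{>k}$/$R(p)_{<k}$: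 smallest element of $R(p)$ above $k$/largest below $k$; $R(p)^*=R(p)\setminus\{\max R(p)\}$. $\Gamma(P,R)$: poset on $\{(p,k):k\in R(p)^*\}$ with covers $(p_1,k_1)\lessdot(p_2,k_2)$ iff (1) $p_1=p_2$ and $k_1=R(p_1)_{>k_2}$, or (2) $p_1\lessdot_Pp_2$, $k_1=R(p_1)_{<k_2}\ne\max R(p_1)$, and no $k\in R(p_2)$ with $k>k_2$ has $R(p_1)_{<k}=k_1$. $\hat R(p)=R(p)\cup\{\min\bigcup_qR(q)-\tilde h(p),\max\bigcup_qR(q)+h(p)\}$, with $h(p)$ ($\tilde h(p)$) the maximum number of elements of a chain of $P$ having top (bottom) element $p$. $\hat B$ is defined on $W=\{(p,\min\hat R(p)^*),(p,\max\hat R(p)^*):p\in P\}\subseteq\Gamma(P,\hat R)$ by $\hat B(p,\min\hat R(p)^*)=\ell-u(p)$, $\hat B(p,\max\hat R(p)^*)=v(p)$; $\mathcal A^{\hat B}(\Gamma(P,\hat R))$ is the set of order-preserving $\sigma:\Gamma(P,\hat R)\to\{0,\ldots,\ell\}$ with $\sigma|_W=\hat B$. For a finite poset $Q$ and order-preserving $\delta,\epsilon:Q\to\{0,\ldots,\ell\}$, $\mathcal A^\delta_\epsilon(Q)$ is the set of order-preserving $\sigma:Q\to\{0,\ldots,\ell\}$ with $\epsilon(x)\le\sigma(x)\le\delta(x)$ for all $x$. -}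

module Defs where

open import Data.Nat as ℕ using (ℕ; suc; _∸_)
open import Data.Integer as ℤ using (ℤ; +_)
open import Data.Fin using (Fin)
open import Data.List using (List; []; _∷ʳ_; length)
open import Data.List.Membership.Propositional using (_∈_)
open import Data.List.Relation.Unary.Linked using (Linked)
open import Data.Product using (Σ; ∃; _×_; _,_)
open import Data.Sum using (_⊎_)
open import Relation.Nullary using (¬_)
open import Relation.Binary.PropositionalEquality using (_≡_; _≢_)
open import Relation.Binary.Construct.Closure.ReflexiveTransitive using (Star)

-- A finite poset P is represented by a carrier Fin n with a partial
-- order _≤P_ (the hypothesis IsPartialOrder _≡_ _≤P_ is in the statement).

module _ {n : ℕ} (_≤P_ : Fin n → Fin n → Set) where

  _<P_ : Fin n → Fin n → Set
  p <P q = p ≤P q × p ≢ q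

  CoversP : Fin n → Fin n → Set
  CoversP p q = p <P q × ¬ (∃ λ z → p <P z × z <P q)

  ChainTop : Fin n → List (Fin n) → Set
  ChainTop p c = Linked _<P_ (c ∷ʳ p)

  ChainBot : Fin n → List (Fin n) → Set
  ChainBot p c = Linked _<P_ (p Data.List.∷ c)

  IsH : (Fin n → ℕ) → Set
  IsH h = ∀ p → (∃ λ c → ChainTop p c × suc (length c) ≡ h p)
                × (∀ c → ChainTop p c → suc (length c) ℕ.≤ h p)

  IsHTilde : (Fin n → ℕ) → Set
  IsHTilde h = ∀ p → (∃ λ c → ChainBot p c × suc (length c) ≡ h p)
                × (∀ c → ChainBot p c → suc (length c) ℕ.≤ h p)

-- The sets P×[ℓ]^v_u, with i ranging over ℕ

InDom : {n : ℕ} → ℕ → (u v : Fin n → ℕ) → Fin n → ℕ → Set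
InDom ℓ u v p i = u p ℕ.< i × i ℕ.< suc ℓ ∸ v p

IsUV : {n : ℕ} → (Fin n → Fin n → Set) → ℕ → (u v : Fin n → ℕ) → Set
IsUV {n} _≤P_ ℓ u v =
  (∀ p → u p ℕ.+ v p ℕ.≤ ℓ) ×
  (∀ p₁ p₂ → p₁ ≤P p₂ → v p₁ ℕ.≤ v p₂ × u p₂ ℕ.≤ u p₁)

-- Restriction functions: R p is a finite nonempty subset of ℤ, given
-- as a nonempty list (membership = list membership).

RestrictionFunction : ℕ → Set
RestrictionFunction n = Fin n → List ℤ

NonEmptyValues : {n : ℕ} → RestrictionFunction n → Set
NonEmptyValues R = ∀ p → R p ≢ []

ConsistentDom : {n : ℕ} → (Fin n → Fin n → Set) → ℕ → (u v : Fin n → ℕ)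
              → RestrictionFunction n → Set
ConsistentDom {n} _≤P_ ℓ u v R =
  ∀ p k → k ∈ R p →
    Σ (Fin n → ℕ → ℤ) λ f →
      (∀ p₁ p₂ i → InDom ℓ u v p₁ i → InDom ℓ u v p₂ i →
         _<P_ _≤P_ p₁ p₂ → f p₁ i ℤ.< f p₂ i) ×
      (∀ q i₁ i₂ → InDom ℓ u v q i₁ → InDom ℓ u v q i₂ →
         i₁ ℕ.≤ i₂ → f q i₁ ℤ.≤ f q i₂) ×
      (∀ x i → InDom ℓ u v x i → f x i ∈ R x) ×
      (∃ λ i → InDom ℓ u v p i × f p i ≡ k)

ConsistentP : {n : ℕ} → (Fin n → Fin n → Set) → RestrictionFunction n → Set
ConsistentP {n} _≤P_ R =
  ∀ p k → k ∈ R p →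
    Σ (Fin n → ℤ) λ f →
      (∀ p₁ p₂ → _<P_ _≤P_ p₁ p₂ → f p₁ ℤ.< f p₂) ×
      (∀ x → f x ∈ R x) ×
      f p ≡ k

module _ {n : ℕ} (S : Fin n → ℤ → Set) where

  IsMax : Fin n → ℤ → Set
  IsMax p k = S p k × (∀ j → S p j → j ℤ.≤ k)

  IsMin : Fin n → ℤ → Set
  IsMin p k = S p k × (∀ j → S p j → k ℤ.≤ j)

  InStar : Fin n → ℤ → Set
  InStar p k = S p k × (∃ λ m → IsMax p m × k ≢ m)

  IsAbove : Fin n → ℤ → ℤ → Set
  IsAbove p k m = S p m × k ℤ.< m × (∀ j → S p j → k ℤ.< j → m ℤ.≤ j)

  IsBelow : Fin n → ℤ → ℤ → Set
  IsBelow p k m = S p m × m ℤ.< k × (∀ j → S p j → j ℤ.< k → j ℤ.≤ m)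

InΓ : {n : ℕ} → (Fin n → ℤ → Set) → Fin n × ℤ → Set
InΓ S (p , k) = InStar S p k

CoverΓ : {n : ℕ} → (Fin n → Fin n → Set) → (Fin n → ℤ → Set)
       → Fin n × ℤ → Fin n × ℤ → Set
CoverΓ {n} _≤P_ S (p₁ , k₁) (p₂ , k₂) =
  InΓ S (p₁ , k₁) × InΓ S (p₂ , k₂) ×
  ( (p₁ ≡ p₂ × IsAbove S p₁ k₂ k₁)
  ⊎ (CoversP _≤P_ p₁ p₂ × IsBelow S p₁ k₂ k₁ × ¬ IsMax S p₁ k₁ ×
     ¬ (∃ λ k → S p₂ k × k₂ ℤ.< k × IsBelow S p₁ k k₁)) )

_≤Γ[_,_]_ : {n : ℕ} → Fin n × ℤ → (Fin n → Fin n → Set) → (Fin n → ℤ → Set)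
          → Fin n × ℤ → Set
x ≤Γ[ _≤P_ , S ] y = Star (CoverΓ _≤P_ S) x y

-- σ is an order-preserving map Γ(P,S) → {0,…,ℓ}.  Labelings are total
-- functions on Fin n × ℤ; only their values on Γ(P,S) matter.
OrderPres : {n : ℕ} → (Fin n → Fin n → Set) → (Fin n → ℤ → Set) → ℕ
          → (Fin n × ℤ → ℕ) → Set
OrderPres _≤P_ S ℓ σ =
  (∀ x → InΓ S x → σ x ℕ.≤ ℓ) ×
  (∀ x y → InΓ S x → InΓ S y → x ≤Γ[ _≤P_ , S ] y → σ x ℕ.≤ σ y)

AgreeOn : {n : ℕ} → (Fin n → ℤ → Set) → (Fin n × ℤ → ℕ) → (Fin n × ℤ → ℕ) → Set
AgreeOn S σ τ = ∀ x → InΓ S x → σ x ≡ τ x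

MemR : {n : ℕ} → RestrictionFunction n → Fin n → ℤ → Set
MemR R p k = k ∈ R p

IsMinUnion : {n : ℕ} → RestrictionFunction n → ℤ → Set
IsMinUnion {n} R m = (∃ λ q → m ∈ R q) × (∀ q k → k ∈ R q → m ℤ.≤ k)

IsMaxUnion : {n : ℕ} → RestrictionFunction n → ℤ → Set
IsMaxUnion {n} R M = (∃ λ q → M ∈ R q) × (∀ q k → k ∈ R q → k ℤ.≤ M)

MemRHat : {n : ℕ} → RestrictionFunction n → (m M : ℤ) → (h h̃ : Fin n → ℕ)
        → Fin n → ℤ → Set
MemRHat R m M h h̃ p k = k ∈ R p ⊎ k ≡ m ℤ.- (+ h̃ p) ⊎ k ≡ M ℤ.+ (+ h p)

InABHat : {n : ℕ} → (Fin n → Fin n → Set) → ℕ → (u v : Fin n → ℕ)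
        → (Fin n → ℤ → Set) → (Fin n × ℤ → ℕ) → Set
InABHat _≤P_ ℓ u v Ŝ σ =
  OrderPres _≤P_ Ŝ ℓ σ ×
  (∀ p k → IsMin (InStar Ŝ) p k → σ (p , k) ≡ ℓ ∸ u p) ×
  (∀ p k → IsMax (InStar Ŝ) p k → σ (p , k) ≡ v p)

InADeltaEps : {n : ℕ} → (Fin n → Fin n → Set) → ℕ → (u v : Fin n → ℕ)
            → (Fin n → ℤ → Set) → (Fin n × ℤ → ℕ) → Set
InADeltaEps _≤P_ ℓ u v S σ =
  OrderPres _≤P_ S ℓ σ ×
  (∀ p k → InΓ S (p , k) → v p ℕ.≤ σ (p , k) × σ (p , k) ℕ.≤ ℓ ∸ u p)

-- R̂(p) is R(p) with a new least element bot p = m − h̃(p) and a new greatest element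
-- top p = M + h(p), so R̂(p)* = R(p) ∪ {bot p}. Hence Γ(P,R̂) is Γ(P,R) together with W, and
-- in the fibre over p the point (p, max R(p)) lies below, and (p, bot p) above, every point
-- of Γ(P,R). Covers of Γ(P,R) remain covers of Γ(P,R̂), and the fibre chain from
-- (p, max R(p)) through (p, k) to (p, bot p) gives v(p) ≤ σ(p,k) ≤ ℓ − u(p); so restriction
-- lands in 𝒜^δ_ε, and it is injective because σ is prescribed on W. Conversely, a labelling
-- τ of Γ(P,R) extends by B̂ on W. Along a cover (p₁,k₁) ⋖ (p₂,k₂) of Γ(P,R̂) with
-- k₂ = bot p₂ or k₁ = max R(p₁), monotonicity of the extension follows from that of u and v
-- along P. Otherwise consistency of R on P puts both endpoints in Γ(P,R) (a cover between
-- fibres with k₂ ∈ R(p₂) has k₁ ∈ R(p₁), and k₁ = max R(p₁) if k₂ = max R(p₂)), where it is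
-- a cover of Γ(P,R) and τ is monotone.
{-# OPTIONS --safe #-}
module Submission where

open import Defs
open import Data.Nat using (ℕ; _≤_)
open import Data.Integer using (ℤ)
open import Data.Fin using (Fin)
open import Data.Product using (Σ; _×_; _,_)
open import Relation.Binary.PropositionalEquality using (_≡_)
open import Relation.Binary.Structures using (IsPartialOrder)

open import Data.Nat as ℕ using (zero; suc; _∸_)
import Data.Nat.Properties as ℕP
open import Data.Integer as ℤ using (+_; +<+; _+_; _-_)
import Data.Integer.Properties as ℤP
open import Data.Integer.Tactic.RingSolver using (solve-∀)
open import Data.List using (List; []; _∷_; filter)
open import Data.List.Membership.Propositional using (_∈_)
open import Data.List.Membership.Propositional.Properties using (∈-filter⁺; ∈-filter⁻)
import Data.List.Relation.Unary.All as All
open import Data.List.Relation.Unary.All.Properties using (all-filter)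
open import Data.List.Relation.Unary.Any using (here; there)
open import Data.List.Extrema ℤP.≤-totalOrder
  using (max; min; argmax-sel; argmin-sel; argmin-all; ⊥≤max; xs≤max; min≤xs)
open import Data.Product using (∃; proj₁; proj₂)
open import Data.Sum using (_⊎_; inj₁; inj₂)
open import Function using (id; _∘_)
open import Relation.Nullary using (¬_; yes; no; contradiction)
open import Relation.Binary.PropositionalEquality using (refl; sym; trans; cong; subst; _≢_; module ≡-Reasoning)
open import Relation.Binary.Construct.Closure.ReflexiveTransitive using (ε; _◅_; _◅◅_)
import Relation.Binary.Construct.Closure.ReflexiveTransitive as Star

maximum : (xs : List ℤ) → xs ≢ [] → ℤ
maximum []       xs≢[] = contradiction refl xs≢[]
maximum (x ∷ xs) _     = max x xs

maximum-∈ : ∀ xs (xs≢[] : xs ≢ []) → maximum xs xs≢[] ∈ xs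
maximum-∈ []       xs≢[] = contradiction refl xs≢[]
maximum-∈ (x ∷ xs) _ with argmax-sel id x xs
... | inj₁ max≡x  = subst (_∈ x ∷ xs) (sym max≡x) (here refl)
... | inj₂ max∈xs = there max∈xs

≤-maximum : ∀ xs (xs≢[] : xs ≢ []) {j} → j ∈ xs → j ℤ.≤ maximum xs xs≢[]
≤-maximum (x ∷ xs) _ (here refl) = ⊥≤max x xs
≤-maximum (x ∷ xs) _ (there j∈) = All.lookup (xs≤max x xs) j∈

least-above : ∀ xs {a b} → a ∈ xs → b ℤ.< a →
              Σ ℤ λ c → c ∈ xs × b ℤ.< c × (∀ j → j ∈ xs → b ℤ.< j → c ℤ.≤ j)
least-above xs {a} {b} a∈ b<a = c , c∈ , b<c , c-least
  where
  above : List ℤ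
  above = filter (b ℤP.<?_) xs
  c : ℤ
  c = min a above
  c∈ : c ∈ xs
  c∈ with argmin-sel id a above
  ... | inj₁ c≡a     = subst (_∈ xs) (sym c≡a) a∈
  ... | inj₂ c∈above = proj₁ (∈-filter⁻ (b ℤP.<?_) c∈above)
  b<c : b ℤ.< c
  b<c = argmin-all id b<a (all-filter (b ℤP.<?_) xs)
  c-least : ∀ j → j ∈ xs → b ℤ.< j → c ℤ.≤ j
  c-least j j∈ b<j = All.lookup (min≤xs a above) (∈-filter⁺ (b ℤP.<?_) j∈ b<j)

private
  +-minus-cancel : ∀ b a → b + (a - b) ≡ a
  +-minus-cancel = solve-∀

  +-suc-swap : ∀ b i → b + (ℤ.1ℤ + i) ≡ (ℤ.1ℤ + b) + i
  +-suc-swap = solve-∀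

module _ {n : ℕ} (S : Fin n → ℤ → Set) {p : Fin n} where

  IsMax-unique : ∀ {a b} → IsMax S p a → IsMax S p b → a ≡ b
  IsMax-unique (Sa , a-max) (Sb , b-max) = ℤP.≤-antisym (b-max _ Sa) (a-max _ Sb)

  IsMin-unique : ∀ {a b} → IsMin S p a → IsMin S p b → a ≡ b
  IsMin-unique (Sa , a-min) (Sb , b-min) = ℤP.≤-antisym (a-min _ Sb) (b-min _ Sa)

  InStar⇒¬IsMax : ∀ {k} → InStar S p k → ¬ IsMax S p k
  InStar⇒¬IsMax (_ , _ , m-max , k≢m) k-max = k≢m (IsMax-unique k-max m-max)

  InStar-downward : ∀ {a c} → InStar S p a → S p c → c ℤ.≤ a → InStar S p c
  InStar-downward (Sa , m , m-max , a≢m) Sc c≤a =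
    Sc , m , m-max , λ { refl → a≢m (ℤP.≤-antisym (proj₂ m-max _ Sa) c≤a) }

module _ {n : ℕ} (_≤P_ : Fin n → Fin n → Set) (S : Fin n → ℤ → Set) where

  CoverΓ⇒≤P : IsPartialOrder _≡_ _≤P_ → ∀ {p₁ k₁ p₂ k₂} →
              CoverΓ _≤P_ S (p₁ , k₁) (p₂ , k₂) → p₁ ≤P p₂
  CoverΓ⇒≤P po (_ , _ , inj₁ (refl , _))        = IsPartialOrder.refl po
  CoverΓ⇒≤P po (_ , _ , inj₂ ((p₁<p₂ , _) , _)) = proj₁ p₁<p₂

  ≤Γ-preserved : (σ : Fin n × ℤ → ℕ) → (∀ {x y} → CoverΓ _≤P_ S x y → σ x ≤ σ y) →
                 ∀ {x y} → x ≤Γ[ _≤P_ , S ] y → σ x ≤ σ y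
  ≤Γ-preserved σ cover-mono = Star.fold (λ x y → σ x ≤ σ y) (ℕP.≤-trans ∘ cover-mono) ℕP.≤-refl

  module _ (p : Fin n) (successor : ∀ {a b} → S p a → b ℤ.< a → Σ ℤ (IsAbove S p b)) where

    -- d is fuel bounding a − b; each cover step strictly raises b.
    private
      descend : ∀ d {a b} → InStar S p a → S p b → b ℤ.≤ a → a ℤ.≤ b + + d →
                (p , a) ≤Γ[ _≤P_ , S ] (p , b)
      descend-strict : ∀ d {a b} → InStar S p a → S p b → b ℤ.< a → a ℤ.≤ b + + d →
                       (p , a) ≤Γ[ _≤P_ , S ] (p , b)

      descend d {a} {b} a* Sb b≤a a≤b+d with a ℤP.≟ b
      ... | yes refl = ε
      ... | no a≢b   = descend-strict d a* Sb (ℤP.≤∧≢⇒< b≤a (a≢b ∘ sym)) a≤b+d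

      descend-strict zero {b = b} _ _ b<a a≤b+0 =
        contradiction (ℤP.≤-trans a≤b+0 (ℤP.≤-reflexive (ℤP.+-identityʳ b))) (ℤP.<⇒≱ b<a)
      descend-strict (suc d) {a} {b} a* Sb b<a a≤b+1+d with successor (proj₁ a*) b<a
      ... | c , c-above@(Sc , b<c , c-least) =
        descend d a* Sc c≤a a≤c+d ◅◅ (c* , b* , inj₁ (refl , c-above)) ◅ ε
        where
        c≤a : c ℤ.≤ a
        c≤a = c-least a (proj₁ a*) b<a
        c* : InStar S p c
        c* = InStar-downward S a* Sc c≤a
        b* : InStar S p b
        b* = InStar-downward S a* Sb (ℤP.<⇒≤ b<a)
        a≤c+d : a ℤ.≤ c + + d
        a≤c+d = ℤP.≤-trans a≤b+1+d (ℤP.≤-trans (ℤP.≤-reflexive (+-suc-swap b (+ d)))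
                  (ℤP.+-monoˡ-≤ (+ d) (ℤP.i<j⇒suc[i]≤j b<c)))

    fibre-descent : ∀ {a b} → InStar S p a → S p b → b ℤ.≤ a → (p , a) ≤Γ[ _≤P_ , S ] (p , b)
    fibre-descent {a} {b} a* Sb b≤a = descend ℤ.∣ a - b ∣ a* Sb b≤a (ℤP.≤-reflexive a≡b+∣a-b∣)
      where
      open ≡-Reasoning
      a≡b+∣a-b∣ : a ≡ b + + ℤ.∣ a - b ∣
      a≡b+∣a-b∣ = begin
        a                ≡⟨ +-minus-cancel b a ⟨
        b + (a - b)      ≡⟨ cong (_+_ b) (ℤP.0≤i⇒+∣i∣≡i (ℤP.i≤j⇒0≤j-i b≤a)) ⟨
        b + + ℤ.∣ a - b ∣ ∎

IsH⇒positive : ∀ {n} {_≤P_ : Fin n → Fin n → Set} {h} → IsH _≤P_ h → ∀ p → 0 ℕ.< h p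
IsH⇒positive h-height p = subst (0 ℕ.<_) (proj₂ (proj₂ (proj₁ (h-height p)))) (ℕP.0<1+n)

IsHTilde⇒positive : ∀ {n} {_≤P_ : Fin n → Fin n → Set} {h̃} → IsHTilde _≤P_ h̃ → ∀ p → 0 ℕ.< h̃ p
IsHTilde⇒positive h̃-height p = subst (0 ℕ.<_) (proj₂ (proj₂ (proj₁ (h̃-height p)))) (ℕP.0<1+n)

module Completion {n : ℕ} (R : RestrictionFunction n) (R≢[] : NonEmptyValues R)
  (m M : ℤ) (m≤R : ∀ q k → k ∈ R q → m ℤ.≤ k) (R≤M : ∀ q k → k ∈ R q → k ℤ.≤ M)
  (h h̃ : Fin n → ℕ) (h>0 : ∀ p → 0 ℕ.< h p) (h̃>0 : ∀ p → 0 ℕ.< h̃ p) where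

  R̂ : Fin n → ℤ → Set
  R̂ = MemRHat R m M h h̃

  bot top maxR : Fin n → ℤ
  bot p  = m - + h̃ p
  top p  = M + + h p
  maxR p = maximum (R p) (R≢[] p)

  maxR∈ : ∀ p → maxR p ∈ R p
  maxR∈ p = maximum-∈ (R p) (R≢[] p)

  ≤maxR : ∀ {p k} → k ∈ R p → k ℤ.≤ maxR p
  ≤maxR {p} = ≤-maximum (R p) (R≢[] p)

  maxR-isMax : ∀ p → IsMax (MemR R) p (maxR p)
  maxR-isMax p = maxR∈ p , λ _ → ≤maxR

  bot<R : ∀ p {q k} → k ∈ R q → bot p ℤ.< k
  bot<R p k∈ = ℤP.<-≤-trans bot<m (m≤R _ _ k∈)
    where
    bot<m : bot p ℤ.< m
    bot<m = subst (bot p ℤ.<_) (ℤP.+-identityʳ m)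
              (ℤP.+-monoʳ-< m (ℤP.neg-mono-< (+<+ (h̃>0 p))))

  R<top : ∀ p {q k} → k ∈ R q → k ℤ.< top p
  R<top p k∈ = ℤP.≤-<-trans (R≤M _ _ k∈) M<top
    where
    M<top : M ℤ.< top p
    M<top = subst (ℤ._< top p) (ℤP.+-identityʳ M) (ℤP.+-monoʳ-< M (+<+ (h>0 p)))

  bot<top : ∀ p q → bot p ℤ.< top q
  bot<top p q = ℤP.<-trans (bot<R p (maxR∈ q)) (R<top q (maxR∈ q))

  top-isMax : ∀ p → IsMax R̂ p (top p)
  top-isMax p = inj₂ (inj₂ refl) , ≤top
    where
    ≤top : ∀ j → R̂ p j → j ℤ.≤ top p
    ≤top j (inj₁ j∈)          = ℤP.<⇒≤ (R<top p j∈)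
    ≤top _ (inj₂ (inj₁ refl)) = ℤP.<⇒≤ (bot<top p p)
    ≤top _ (inj₂ (inj₂ refl)) = ℤP.≤-refl

  bot≤R̂ : ∀ {p k} → R̂ p k → bot p ℤ.≤ k
  bot≤R̂ {p} (inj₁ k∈)          = ℤP.<⇒≤ (bot<R p k∈)
  bot≤R̂     (inj₂ (inj₁ refl)) = ℤP.≤-refl
  bot≤R̂ {p} (inj₂ (inj₂ refl)) = ℤP.<⇒≤ (bot<top p p)

  R̂-interior : ∀ {p k} → R̂ p k → bot p ℤ.< k → k ℤ.< top p → k ∈ R p
  R̂-interior (inj₁ k∈)          _       _       = k∈
  R̂-interior (inj₂ (inj₁ refl)) bot<bot _       = contradiction bot<bot (ℤP.<-irrefl refl)
  R̂-interior (inj₂ (inj₂ refl)) _       top<top = contradiction top<top (ℤP.<-irrefl refl)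

  R⊆R̂* : ∀ {p k} → k ∈ R p → InStar R̂ p k
  R⊆R̂* {p} k∈ = inj₁ k∈ , top p , top-isMax p , ℤP.<⇒≢ (R<top p k∈)

  Γ-inclusion : ∀ x → InΓ (MemR R) x → InΓ R̂ x
  Γ-inclusion _ (k∈ , _) = R⊆R̂* k∈

  bot∈R̂* : ∀ p → InStar R̂ p (bot p)
  bot∈R̂* p = inj₂ (inj₁ refl) , top p , top-isMax p , ℤP.<⇒≢ (bot<top p p)

  R̂*-cases : ∀ {p k} → InStar R̂ p k → k ≡ bot p ⊎ k ∈ R p
  R̂*-cases     (inj₁ k∈ , _)          = inj₂ k∈
  R̂*-cases     (inj₂ (inj₁ k≡bot) , _) = inj₁ k≡bot
  R̂*-cases {p} k*@(inj₂ (inj₂ refl) , _) = contradiction (top-isMax p) (InStar⇒¬IsMax R̂ k*)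

  R*⇒≢maxR : ∀ {p k} → InStar (MemR R) p k → k ≢ maxR p
  R*⇒≢maxR {p} k* refl = InStar⇒¬IsMax (MemR R) k* (maxR-isMax p)

  R̂*-trichotomy : ∀ {p k} → InStar R̂ p k → k ≡ bot p ⊎ k ≡ maxR p ⊎ InStar (MemR R) p k
  R̂*-trichotomy {p} {k} k* with R̂*-cases k* | k ℤP.≟ maxR p
  ... | inj₁ k≡bot | _          = inj₁ k≡bot
  ... | inj₂ _     | yes k≡maxR = inj₂ (inj₁ k≡maxR)
  ... | inj₂ k∈    | no k≢maxR  = inj₂ (inj₂ (k∈ , maxR p , maxR-isMax p , k≢maxR))

  bot-isMin* : ∀ p → IsMin (InStar R̂) p (bot p)
  bot-isMin* p = bot∈R̂* p , λ _ j* → bot≤R̂ (proj₁ j*)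

  maxR-isMax* : ∀ p → IsMax (InStar R̂) p (maxR p)
  maxR-isMax* p = R⊆R̂* (maxR∈ p) , ≤maxR*
    where
    ≤maxR* : ∀ j → InStar R̂ p j → j ℤ.≤ maxR p
    ≤maxR* j j* with R̂*-cases j*
    ... | inj₁ refl = ℤP.<⇒≤ (bot<R p (maxR∈ p))
    ... | inj₂ j∈   = ≤maxR j∈

  fibre : Fin n → List ℤ
  fibre p = bot p ∷ top p ∷ R p

  R̂⇒∈fibre : ∀ {p j} → R̂ p j → j ∈ fibre p
  R̂⇒∈fibre (inj₁ j∈)          = there (there j∈)
  R̂⇒∈fibre (inj₂ (inj₁ refl)) = here refl
  R̂⇒∈fibre (inj₂ (inj₂ refl)) = there (here refl)

  ∈fibre⇒R̂ : ∀ {p j} → j ∈ fibre p → R̂ p j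
  ∈fibre⇒R̂ (here j≡bot)         = inj₂ (inj₁ j≡bot)
  ∈fibre⇒R̂ (there (here j≡top)) = inj₂ (inj₂ j≡top)
  ∈fibre⇒R̂ (there (there j∈))   = inj₁ j∈

  R̂-successor : ∀ p {a b} → R̂ p a → b ℤ.< a → Σ ℤ (IsAbove R̂ p b)
  R̂-successor p Ra b<a with least-above (fibre p) (R̂⇒∈fibre Ra) b<a
  ... | c , c∈ , b<c , c-least = c , ∈fibre⇒R̂ c∈ , b<c , λ j → c-least j ∘ R̂⇒∈fibre

  IsAbove-R⇒R̂ : ∀ {p k c} → k ∈ R p → IsAbove (MemR R) p k c → IsAbove R̂ p k c
  IsAbove-R⇒R̂ {p} {k} {c} k∈ (c∈ , k<c , c-least) = inj₁ c∈ , k<c , ĉ-least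
    where
    ĉ-least : ∀ j → R̂ p j → k ℤ.< j → c ℤ.≤ j
    ĉ-least j (inj₁ j∈)          = c-least j j∈
    ĉ-least _ (inj₂ (inj₁ refl)) k<bot = contradiction k<bot (ℤP.<-asym (bot<R p k∈))
    ĉ-least _ (inj₂ (inj₂ refl)) _     = ℤP.<⇒≤ (R<top p c∈)

  IsBelow-R⇒R̂ : ∀ {p q k c} → k ∈ R q → IsBelow (MemR R) p k c → IsBelow R̂ p k c
  IsBelow-R⇒R̂ {p} {_} {k} {c} k∈ (c∈ , c<k , c-greatest) = inj₁ c∈ , c<k , ĉ-greatest
    where
    ĉ-greatest : ∀ j → R̂ p j → j ℤ.< k → j ℤ.≤ c
    ĉ-greatest j (inj₁ j∈)          = c-greatest j j∈
    ĉ-greatest _ (inj₂ (inj₁ refl)) _     = ℤP.<⇒≤ (bot<R p c∈)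
    ĉ-greatest _ (inj₂ (inj₂ refl)) top<k = contradiction top<k (ℤP.<-asym (R<top p k∈))

  IsAbove-R̂⇒R : ∀ {p k c} → c ∈ R p → IsAbove R̂ p k c → IsAbove (MemR R) p k c
  IsAbove-R̂⇒R c∈ (_ , k<c , c-least) = c∈ , k<c , λ j → c-least j ∘ inj₁

  IsBelow-R̂⇒R : ∀ {p k c} → c ∈ R p → IsBelow R̂ p k c → IsBelow (MemR R) p k c
  IsBelow-R̂⇒R c∈ (_ , c<k , c-greatest) = c∈ , c<k , λ j → c-greatest j ∘ inj₁

  below-top⇒isMax : ∀ {p q c} → c ∈ R p → IsBelow R̂ p (top q) c → IsMax (MemR R) p c
  below-top⇒isMax {q = q} c∈ (_ , _ , c-greatest) =
    c∈ , λ j j∈ → c-greatest j (inj₁ j∈) (R<top q j∈)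

  module _ (_≤P_ : Fin n → Fin n → Set) where

    CoverΓ-R⇒R̂ : ∀ {x y} → CoverΓ _≤P_ (MemR R) x y → CoverΓ _≤P_ R̂ x y
    CoverΓ-R⇒R̂ {x} {y} (k₁* , k₂* , inj₁ (refl , k₁-above)) =
      Γ-inclusion x k₁* , Γ-inclusion y k₂* , inj₁ (refl , IsAbove-R⇒R̂ (proj₁ k₂*) k₁-above)
    CoverΓ-R⇒R̂ {p₁ , k₁} {p₂ , k₂} (k₁* , k₂* , inj₂ (p₁⋖p₂ , k₁-below , k₁-not-max , no-k)) =
      R⊆R̂* (proj₁ k₁*) , R⊆R̂* (proj₁ k₂*) ,
      inj₂ (p₁⋖p₂ , IsBelow-R⇒R̂ (proj₁ k₂*) k₁-below , InStar⇒¬IsMax R̂ (R⊆R̂* (proj₁ k₁*)) , no-k̂)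
      where
      no-k̂ : ¬ (∃ λ k → R̂ p₂ k × k₂ ℤ.< k × IsBelow R̂ p₁ k k₁)
      no-k̂ (k , inj₁ k∈ , k₂<k , k₁-below-k) =
        no-k (k , k∈ , k₂<k , IsBelow-R̂⇒R (proj₁ k₁*) k₁-below-k)
      no-k̂ (_ , inj₂ (inj₁ refl) , k₂<bot , _) = ℤP.<-asym (bot<R p₂ (proj₁ k₂*)) k₂<bot
      no-k̂ (_ , inj₂ (inj₂ refl) , _ , k₁-below-top) =
        k₁-not-max (below-top⇒isMax (proj₁ k₁*) k₁-below-top)

    CoverΓ-R̂⇒R : ∀ {p₁ k₁ p₂ k₂} → InStar (MemR R) p₁ k₁ → InStar (MemR R) p₂ k₂ →
                 CoverΓ _≤P_ R̂ (p₁ , k₁) (p₂ , k₂) → CoverΓ _≤P_ (MemR R) (p₁ , k₁) (p₂ , k₂)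
    CoverΓ-R̂⇒R k₁* k₂* (_ , _ , inj₁ (refl , k₁-above)) =
      k₁* , k₂* , inj₁ (refl , IsAbove-R̂⇒R (proj₁ k₁*) k₁-above)
    CoverΓ-R̂⇒R k₁* k₂* (_ , _ , inj₂ (p₁⋖p₂ , k₁-below , _ , no-k̂)) =
      k₁* , k₂* ,
      inj₂ (p₁⋖p₂ , IsBelow-R̂⇒R (proj₁ k₁*) k₁-below , InStar⇒¬IsMax (MemR R) k₁* ,
            λ (k , k∈ , k₂<k , k₁-below-k) → no-k̂ (k , inj₁ k∈ , k₂<k , IsBelow-R⇒R̂ k∈ k₁-below-k))

    R̂-descent : ∀ p {a b} → InStar R̂ p a → R̂ p b → b ℤ.≤ a → (p , a) ≤Γ[ _≤P_ , R̂ ] (p , b)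
    R̂-descent p = fibre-descent _≤P_ R̂ p (R̂-successor p)

    module _ (consistent : ConsistentP _≤P_ R) where

      cover-source∈R : ∀ {p₁ k₁ p₂ k₂} → _<P_ _≤P_ p₁ p₂ → IsBelow R̂ p₁ k₂ k₁ → k₂ ∈ R p₂ →
                       k₁ ∈ R p₁
      cover-source∈R {p₁} {k₁} {p₂} p₁<p₂ (Rk₁ , k₁<k₂ , k₁-greatest) k₂∈
        with consistent p₂ _ k₂∈
      ... | f , f-strict , f∈R , refl =
        R̂-interior Rk₁ (ℤP.<-≤-trans (bot<R p₁ (f∈R p₁)) f₁≤k₁) (ℤP.<-trans k₁<k₂ (R<top p₁ k₂∈))
        where
        f₁≤k₁ : f p₁ ℤ.≤ k₁
        f₁≤k₁ = k₁-greatest (f p₁) (inj₁ (f∈R p₁)) (f-strict p₁ p₂ p₁<p₂)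

      cover-into-maxR : ∀ {p₁ k₁ p₂} → _<P_ _≤P_ p₁ p₂ → IsBelow R̂ p₁ (maxR p₂) k₁ →
                        k₁ ≡ maxR p₁
      cover-into-maxR {p₁} {_} {p₂} p₁<p₂ k₁-below@(_ , _ , k₁-greatest)
        with consistent p₁ (maxR p₁) (maxR∈ p₁)
      ... | f , f-strict , f∈R , f₁≡maxR =
        ℤP.≤-antisym (≤maxR (cover-source∈R p₁<p₂ k₁-below (maxR∈ p₂)))
                     (k₁-greatest (maxR p₁) (inj₁ (maxR∈ p₁)) maxR₁<maxR₂)
        where
        open ℤP.≤-Reasoning
        maxR₁<maxR₂ : maxR p₁ ℤ.< maxR p₂
        maxR₁<maxR₂ = begin-strict
          maxR p₁ ≡⟨ f₁≡maxR ⟨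
          f p₁    <⟨ f-strict p₁ p₂ p₁<p₂ ⟩
          f p₂    ≤⟨ ≤maxR (f∈R p₂) ⟩
          maxR p₂ ∎

      cover-into-R : ∀ {p₁ k₁ p₂ k₂} → CoverΓ _≤P_ R̂ (p₁ , k₁) (p₂ , k₂) → k₂ ∈ R p₂ →
                     k₁ ∈ R p₁ × (k₂ ≡ maxR p₂ → k₁ ≡ maxR p₁)
      cover-into-R {p} {k₁} (k₁* , _ , inj₁ (refl , _ , k₂<k₁ , _)) k₂∈ =
        k₁∈ , λ { refl → contradiction (≤maxR k₁∈) (ℤP.<⇒≱ k₂<k₁) }
        where
        k₁∈ : k₁ ∈ R p
        k₁∈ with R̂*-cases k₁*
        ... | inj₁ refl = contradiction k₂<k₁ (ℤP.<-asym (bot<R p k₂∈))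
        ... | inj₂ k₁∈  = k₁∈
      cover-into-R (_ , _ , inj₂ ((p₁<p₂ , _) , k₁-below , _)) k₂∈ =
        cover-source∈R p₁<p₂ k₁-below k₂∈ , λ { refl → cover-into-maxR p₁<p₂ k₁-below }

      cover-interior : ∀ {p₁ k₁ p₂ k₂} → CoverΓ _≤P_ R̂ (p₁ , k₁) (p₂ , k₂) →
                       k₂ ≢ bot p₂ → k₁ ≢ maxR p₁ →
                       InStar (MemR R) p₁ k₁ × InStar (MemR R) p₂ k₂
      cover-interior {p₁} {_} {p₂} c@(_ , k₂* , _) k₂≢bot k₁≢maxR with R̂*-cases k₂*
      ... | inj₁ k₂≡bot = contradiction k₂≡bot k₂≢bot
      ... | inj₂ k₂∈ with cover-into-R c k₂∈
      ...   | k₁∈ , k₁≡maxR-if =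
        (k₁∈ , maxR p₁ , maxR-isMax p₁ , k₁≢maxR) ,
        (k₂∈ , maxR p₂ , maxR-isMax p₂ , k₁≢maxR ∘ k₁≡maxR-if)

    module _ (ℓ : ℕ) (u v : Fin n → ℕ) where

      restrict-mem : ∀ {σ} → InABHat _≤P_ ℓ u v R̂ σ → InADeltaEps _≤P_ ℓ u v (MemR R) σ
      restrict-mem {σ} ((σ≤ℓ , σ-mono) , σ-bot , σ-maxR) =
        ((λ x → σ≤ℓ x ∘ Γ-inclusion x) ,
         (λ x y x* y* → σ-mono x y (Γ-inclusion x x*) (Γ-inclusion y y*) ∘ Star.map CoverΓ-R⇒R̂)) ,
        bounds
        where
        bounds : ∀ p k → InΓ (MemR R) (p , k) → v p ≤ σ (p , k) × σ (p , k) ≤ ℓ ∸ u p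
        bounds p k k*@(k∈ , _) = v≤σ , σ≤ℓ∸u
          where
          open ℕP.≤-Reasoning
          k̂* : InStar R̂ p k
          k̂* = Γ-inclusion (p , k) k*
          maxR* : InStar R̂ p (maxR p)
          maxR* = proj₁ (maxR-isMax* p)
          v≤σ : v p ≤ σ (p , k)
          v≤σ = begin
            v p            ≡⟨ σ-maxR p _ (maxR-isMax* p) ⟨
            σ (p , maxR p) ≤⟨ σ-mono _ _ maxR* k̂* (R̂-descent p maxR* (inj₁ k∈) (≤maxR k∈)) ⟩
            σ (p , k)      ∎
          σ≤ℓ∸u : σ (p , k) ≤ ℓ ∸ u p
          σ≤ℓ∸u = begin
            σ (p , k)      ≤⟨ σ-mono _ _ k̂* (bot∈R̂* p)
                                (R̂-descent p k̂* (inj₂ (inj₁ refl)) (ℤP.<⇒≤ (bot<R p k∈))) ⟩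
            σ (p , bot p)  ≡⟨ σ-bot p _ (bot-isMin* p) ⟩
            ℓ ∸ u p        ∎

      restrict-injective : ∀ {σ σ′} → InABHat _≤P_ ℓ u v R̂ σ → InABHat _≤P_ ℓ u v R̂ σ′ →
                           AgreeOn (MemR R) σ σ′ → AgreeOn R̂ σ σ′
      restrict-injective (_ , σ-bot , σ-maxR) (_ , σ′-bot , σ′-maxR) σ≡σ′ (p , k) k*
        with R̂*-trichotomy k*
      ... | inj₁ refl          = trans (σ-bot p _ (bot-isMin* p)) (sym (σ′-bot p _ (bot-isMin* p)))
      ... | inj₂ (inj₁ refl)   = trans (σ-maxR p _ (maxR-isMax* p)) (sym (σ′-maxR p _ (maxR-isMax* p)))
      ... | inj₂ (inj₂ k∈R*)   = σ≡σ′ (p , k) k∈R*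

      module Extension (τ : Fin n × ℤ → ℕ) where

        -- Opaque, so that case splits on the same decisions in later proofs leave it folded.
        opaque
          extend : Fin n × ℤ → ℕ
          extend (p , k) with k ℤP.≟ bot p | k ℤP.≟ maxR p
          ... | yes _ | _     = ℓ ∸ u p
          ... | no _  | yes _ = v p
          ... | no _  | no _  = τ (p , k)

          extend-bot : ∀ p → extend (p , bot p) ≡ ℓ ∸ u p
          extend-bot p with bot p ℤP.≟ bot p | bot p ℤP.≟ maxR p
          ... | yes _    | _ = refl
          ... | no b≢b   | _ = contradiction refl b≢b

          extend-maxR : ∀ p → extend (p , maxR p) ≡ v p
          extend-maxR p with maxR p ℤP.≟ bot p | maxR p ℤP.≟ maxR p
          ... | yes maxR≡bot | _      = contradiction (sym maxR≡bot) (ℤP.<⇒≢ (bot<R p (maxR∈ p)))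
          ... | no _         | yes _  = refl
          ... | no _         | no m≢m = contradiction refl m≢m

          extend-R* : ∀ {p k} → InStar (MemR R) p k → extend (p , k) ≡ τ (p , k)
          extend-R* {p} {k} k*@(k∈ , _) with k ℤP.≟ bot p | k ℤP.≟ maxR p
          ... | yes refl | _         = contradiction (bot<R p k∈) (ℤP.<-irrefl refl)
          ... | no _     | yes k≡max = contradiction k≡max (R*⇒≢maxR k*)
          ... | no _     | no _      = refl

        extend-agrees : AgreeOn (MemR R) extend τ
        extend-agrees _ = extend-R*

        module _ (po : IsPartialOrder _≡_ _≤P_) (uv : IsUV _≤P_ ℓ u v)
                 (consistent : ConsistentP _≤P_ R)
                 (τ-mem : InADeltaEps _≤P_ ℓ u v (MemR R) τ) where

          v≤ℓ∸u : ∀ p → v p ≤ ℓ ∸ u p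
          v≤ℓ∸u p = ℕP.m+n≤o⇒m≤o∸n (v p) (subst (_≤ ℓ) (ℕP.+-comm (u p) (v p)) (proj₁ uv p))

          uv-along-cover : ∀ {p₁ k₁ p₂ k₂} → CoverΓ _≤P_ R̂ (p₁ , k₁) (p₂ , k₂) →
                           v p₁ ≤ v p₂ × u p₂ ≤ u p₁
          uv-along-cover {p₁} {_} {p₂} c = proj₂ uv p₁ p₂ (CoverΓ⇒≤P _≤P_ R̂ po c)

          extend≤ℓ∸u : ∀ {p k} → InStar R̂ p k → extend (p , k) ≤ ℓ ∸ u p
          extend≤ℓ∸u {p} k* with R̂*-trichotomy k*
          ... | inj₁ refl        = ℕP.≤-reflexive (extend-bot p)
          ... | inj₂ (inj₁ refl) = subst (_≤ ℓ ∸ u p) (sym (extend-maxR p)) (v≤ℓ∸u p)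
          ... | inj₂ (inj₂ k∈R*) =
            subst (_≤ ℓ ∸ u p) (sym (extend-R* k∈R*)) (proj₂ (proj₂ τ-mem p _ k∈R*))

          v≤extend : ∀ {p k} → InStar R̂ p k → k ≢ bot p → v p ≤ extend (p , k)
          v≤extend {p} k* k≢bot with R̂*-trichotomy k*
          ... | inj₁ k≡bot       = contradiction k≡bot k≢bot
          ... | inj₂ (inj₁ refl) = ℕP.≤-reflexive (sym (extend-maxR p))
          ... | inj₂ (inj₂ k∈R*) =
            subst (v p ≤_) (sym (extend-R* k∈R*)) (proj₁ (proj₂ τ-mem p _ k∈R*))

          extend-cover-mono : ∀ {x y} → CoverΓ _≤P_ R̂ x y → extend x ≤ extend y
          extend-cover-mono {p₁ , k₁} {p₂ , k₂} c with k₂ ℤP.≟ bot p₂ | k₁ ℤP.≟ maxR p₁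
          ... | yes refl | _ = begin
            extend (p₁ , k₁)      ≤⟨ extend≤ℓ∸u (proj₁ c) ⟩
            ℓ ∸ u p₁              ≤⟨ ℕP.∸-monoʳ-≤ ℓ (proj₂ (uv-along-cover c)) ⟩
            ℓ ∸ u p₂              ≡⟨ extend-bot p₂ ⟨
            extend (p₂ , bot p₂)  ∎
            where open ℕP.≤-Reasoning
          ... | no k₂≢bot | yes refl = begin
            extend (p₁ , maxR p₁) ≡⟨ extend-maxR p₁ ⟩
            v p₁                  ≤⟨ proj₁ (uv-along-cover c) ⟩
            v p₂                  ≤⟨ v≤extend (proj₁ (proj₂ c)) k₂≢bot ⟩
            extend (p₂ , k₂)      ∎
            where open ℕP.≤-Reasoning
          ... | no k₂≢bot | no k₁≢maxR with cover-interior consistent c k₂≢bot k₁≢maxR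
          ...   | k₁* , k₂* = begin
            extend (p₁ , k₁)      ≡⟨ extend-R* k₁* ⟩
            τ (p₁ , k₁)           ≤⟨ proj₂ (proj₁ τ-mem) _ _ k₁* k₂* (CoverΓ-R̂⇒R k₁* k₂* c ◅ ε) ⟩
            τ (p₂ , k₂)           ≡⟨ extend-R* k₂* ⟨
            extend (p₂ , k₂)      ∎
            where open ℕP.≤-Reasoning

          extend-mem : InABHat _≤P_ ℓ u v R̂ extend
          extend-mem =
            ((λ { (p , _) k* → ℕP.≤-trans (extend≤ℓ∸u k*) (ℕP.m∸n≤m ℓ (u p)) }) ,
             (λ _ _ _ _ → ≤Γ-preserved _≤P_ R̂ extend extend-cover-mono)) ,
            (λ p _ k-min → trans (cong (extend ∘ (p ,_)) (IsMin-unique (InStar R̂) k-min (bot-isMin* p)))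
                                 (extend-bot p)) ,
            (λ p _ k-max → trans (cong (extend ∘ (p ,_)) (IsMax-unique (InStar R̂) k-max (maxR-isMax* p)))
                                 (extend-maxR p))

proposition2p26 :
    (n : ℕ) (_≤P_ : Fin n → Fin n → Set) → IsPartialOrder _≡_ _≤P_ →
    (ℓ : ℕ) → 1 ≤ ℓ → (u v : Fin n → ℕ) → IsUV _≤P_ ℓ u v →
    (R : RestrictionFunction n) → NonEmptyValues R →
    ConsistentDom _≤P_ ℓ u v R → ConsistentP _≤P_ R →
    (m M : ℤ) → IsMinUnion R m → IsMaxUnion R M →
    (h h̃ : Fin n → ℕ) → IsH _≤P_ h → IsHTilde _≤P_ h̃ →
    -- Γ(P,R) ⊆ Γ(P,R̂)
    (∀ x → InΓ (MemR R) x → InΓ (MemRHat R m M h h̃) x) ×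
    -- restriction maps 𝒜^{B̂}(Γ(P,R̂)) into 𝒜^δ_ε(Γ(P,R))
    (∀ σ → InABHat _≤P_ ℓ u v (MemRHat R m M h h̃) σ →
       InADeltaEps _≤P_ ℓ u v (MemR R) σ) ×
    -- injective
    (∀ σ σ′ → InABHat _≤P_ ℓ u v (MemRHat R m M h h̃) σ →
       InABHat _≤P_ ℓ u v (MemRHat R m M h h̃) σ′ →
       AgreeOn (MemR R) σ σ′ → AgreeOn (MemRHat R m M h h̃) σ σ′) ×
    -- surjective
    (∀ τ → InADeltaEps _≤P_ ℓ u v (MemR R) τ →
       Σ (Fin n × ℤ → ℕ) λ σ → InABHat _≤P_ ℓ u v (MemRHat R m M h h̃) σ ×
         AgreeOn (MemR R) σ τ)
proposition2p26 n _≤P_ po ℓ _ u v uv R R≢[] _ consistent m M m-min M-max h h̃ h-height h̃-height =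
  Γ-inclusion ,
  (λ _ → restrict-mem _≤P_ ℓ u v) ,
  (λ _ _ → restrict-injective _≤P_ ℓ u v) ,
  λ τ τ-mem → let open Extension _≤P_ ℓ u v τ in
    extend , extend-mem po uv consistent τ-mem , extend-agrees
  where
  open Completion R R≢[] m M (proj₂ m-min) (proj₂ M-max) h h̃
                  (IsH⇒positive h-height) (IsHTilde⇒positive h̃-height)
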